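{- For any $n\in\mathbb{N}$ with $n>1$, there is no $p\in\beta\mathbb{N}$ with $p\star_n p=p$ and $p\in K(\beta\mathbb{N},+)\cup E(\beta\mathbb{N},+)$.
   Context: $\beta\mathbb{N}$ is the set of ultrafilters on $\mathbb{N}$, with the extended addition: $B\in p+r$ iff $\{x:\{y:x+y\in B\}\in r\}\in p$. $K(\beta\mathbb{N},+)$ is the smallest two-sided ideal of $(\beta\mathbb{N},+)$ and $E(\beta\mathbb{N},+)$ its set of idempotents ($p+p=p$). For $p,q\in\beta\mathbb{N}$, $p\star_n q$ is defined by $B\in p\star_n q$ iff $\{a\in\mathbb{N}:\{b\in\mathbb{N}:n^a b\in B\}\in q\}\in p$. -}

module Defs where

open import Level using (0ℓ) renaming (suc to lsuc)
open import Data.Nat using (ℕ; zero; suc; _+_; _*_; _^_; _≤_; _<_; s≤s; z≤n)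
open import Data.Nat.Properties using (m^n>0; *-mono-≤; +-mono-≤)
open import Data.Product using (Σ; _×_; _,_)
open import Data.Sum using (_⊎_; inj₁; inj₂)
open import Data.Empty using (⊥; ⊥-elim)
open import Relation.Nullary using (¬_)
open import Relation.Unary using (Pred; _⊆_; _∩_; ∁; ∅)

-- The paper's ℕ is {1,2,3,...}.  We encode βℕ as the ultrafilters on
-- Agda's ℕ = {0,1,2,...} that contain the set of positive naturals;
-- these are in canonical bijection with the ultrafilters on {1,2,...}.
record Ultrafilter : Set₁ where
  field
    mem      : Pred ℕ 0ℓ → Set
    upward   : ∀ {A B} → A ⊆ B → mem A → mem B
    inter    : ∀ {A B} → mem A → mem B → mem (A ∩ B)
    proper   : ¬ mem ∅
    ultra    : ∀ A → mem A ⊎ mem (∁ A)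
    positive : mem (λ x → 1 ≤ x)

open Ultrafilter public

_≈_ : Ultrafilter → Ultrafilter → Set₁
p ≈ q = ∀ A → (mem p A → mem q A) × (mem q A → mem p A)

infix 4 _≈_

lift : (f : ℕ → ℕ → ℕ) →
       (∀ a b → 1 ≤ a → 1 ≤ b → 1 ≤ f a b) →
       Ultrafilter → Ultrafilter → Ultrafilter
lift f fpos p q = record
  { mem      = λ B → mem p (λ a → mem q (λ b → B (f a b)))
  ; upward   = λ A⊆B h → upward p (λ hq → upward q A⊆B hq) h
  ; inter    = λ hA hB → upward p (λ { (x , y) → inter q x y }) (inter p hA hB)
  ; proper   = λ h → proper p (upward p (λ hq → proper q hq) h)
  ; ultra    = λ B → ultraL B
  ; positive = upward p (λ {a} a≥1 →
                 upward q (λ {b} b≥1 → fpos a b a≥1 b≥1) (positive q))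
                 (positive p)
  }
  where
  ultraL : ∀ B → mem p (λ a → mem q (λ b → B (f a b)))
               ⊎ mem p (λ a → mem q (λ b → ¬ B (f a b)))
  ultraL B with ultra p (λ a → mem q (λ b → B (f a b)))
  ... | inj₁ h = inj₁ h
  ... | inj₂ h = inj₂ (upward p (λ {a} nx → pick a nx) h)
    where
    pick : ∀ a → ¬ mem q (λ b → B (f a b)) → mem q (λ b → ¬ B (f a b))
    pick a nx with ultra q (λ b → B (f a b))
    ... | inj₁ m = ⊥-elim (nx m)
    ... | inj₂ m = m

_⊕_ : Ultrafilter → Ultrafilter → Ultrafilter
_⊕_ = lift _+_ (λ a b a≥1 _ → +-mono-≤ a≥1 z≤n)

infixl 6 _⊕_

star-pos : ∀ n → 1 < n → ∀ a b → 1 ≤ a → 1 ≤ b → 1 ≤ n ^ a * b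
star-pos (suc (suc k)) (s≤s (s≤s z≤n)) a b _ b≥1 = *-mono-≤ (m^n>0 (suc (suc k)) a) b≥1

star : (n : ℕ) → 1 < n → Ultrafilter → Ultrafilter → Ultrafilter
star n 1<n = lift (λ a b → n ^ a * b) (star-pos n 1<n)

record IsIdeal (I : Pred Ultrafilter (lsuc 0ℓ)) : Set₂ where
  field
    nonempty : Σ Ultrafilter I
    respects : ∀ {p q} → p ≈ q → I p → I q
    left     : ∀ p q → I q → I (p ⊕ q)
    right    : ∀ p q → I p → I (p ⊕ q)

-- Membership in K(βℕ,+), the smallest two-sided ideal, i.e. the
-- intersection of all two-sided ideals.
InK : Ultrafilter → Set₂
InK p = ∀ (J : Pred Ultrafilter (lsuc 0ℓ)) → IsIdeal J → J p

InE : Ultrafilter → Set₁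
InE p = p ⊕ p ≈ p

module Submission where

open import Defs
open import Data.Nat using (ℕ; _<_)
open import Data.Sum using (_⊎_)
open import Relation.Nullary using (¬_)

open import Level using (0ℓ) renaming (suc to lsuc)
open import Function using (id)
open import Data.Nat
  using (zero; suc; _+_; _*_; _∸_; _^_; _%_; _/_; _≤_; _≤?_; z≤n; s≤s; NonZero; >-nonZero)
open import Data.Nat.Properties
open import Data.Nat.DivMod
  using (m≡m%n+[m/n]*n; m%n<n; m%n%n≡m%n; m<n⇒m%n≡m; %-distribˡ-+)
open import Data.Nat.Divisibility
  using (_∣_; divides; _∣?_; ∣-trans; 1∣_; _∣0; ∣⇒≤; >⇒∤; ∣m+n∣m⇒∣n; *-monoʳ-∣; *-cancelˡ-∣)
open import Data.Product using (Σ; ∃-syntax; _×_; _,_; proj₁; proj₂; swap)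
open import Data.Sum using (inj₁; inj₂; map; [_,_])
open import Data.Unit using (tt)
open import Data.Empty using (⊥-elim)
open import Relation.Nullary using (Dec; yes; no)
open import Relation.Unary using (Pred; Decidable; U; ∁)
open import Relation.Binary.Bundles using (Setoid)
open import Relation.Binary.Structures using (IsEquivalence)
open import Relation.Binary.Definitions using (tri<; tri≈; tri>)
open import Relation.Binary.PropositionalEquality
  using (_≡_; refl; sym; trans; cong; subst; module ≡-Reasoning)
import Relation.Binary.Reasoning.Setoid as ≈-Reasoning

-- Suppose p ⋆ p = p and s + u = p with s, u non-principal: p ∈ K yields
-- (s' + p) + (p + u') = p, idempotence yields p + p = p, and p ⋆ p = p forces
-- p to be non-principal.  Let ν be the n-adic valuation and ⌊log⌋ the base-n
-- logarithm.  For all y but at most one, ν (y + v) is u-almost constant, say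
-- equal to j, since two exceptions y < y' would make n ^ y' divide y' - y; so
-- s-almost every y is of this kind.  Let ρ j be the u-almost sure residue of
-- ⌊log⌋ v modulo 2 + j, and call x typical when ⌊log⌋ x is ρ (ν x) or
-- ρ (ν x) + 1 modulo 2 + ν x.  As ⌊log⌋ (y + v) ∈ {⌊log⌋ v, ⌊log⌋ v + 1} for
-- y ≤ v, the typical numbers belong to s + u = p.  Multiplying by n ^ α adds α
-- to both ν and ⌊log⌋, so ⌊log⌋ (n ^ α (y + v)) exceeds ⌊log⌋ v by α or α + 1,
-- which for α ≥ 2 is neither 0 nor 1 modulo the new modulus 2 + α + j.  Hence
-- the atypical numbers belong to p ⋆ (s + u) = p ⋆ p = p.

≈-isEquivalence : IsEquivalence _≈_
≈-isEquivalence = record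
  { refl  = λ _ → id , id
  ; sym   = λ p≈q A → swap (p≈q A)
  ; trans = λ p≈q q≈r A → (λ h → proj₁ (q≈r A) (proj₁ (p≈q A) h))
                        , (λ h → proj₂ (p≈q A) (proj₂ (q≈r A) h))
  }

≈-setoid : Setoid (lsuc 0ℓ) (lsuc 0ℓ)
≈-setoid = record { isEquivalence = ≈-isEquivalence }

open Setoid ≈-setoid using () renaming (refl to ≈-refl)

⊕-congʳ : ∀ p {q₁ q₂} → q₁ ≈ q₂ → p ⊕ q₁ ≈ p ⊕ q₂
⊕-congʳ p q₁≈q₂ A = upward p (proj₁ (q₁≈q₂ _)) , upward p (proj₂ (q₁≈q₂ _))

⊕-congˡ : ∀ {p₁ p₂} q → p₁ ≈ p₂ → p₁ ⊕ q ≈ p₂ ⊕ q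
⊕-congˡ q p₁≈p₂ A = p₁≈p₂ _

⊕-assoc : ∀ p q r → (p ⊕ q) ⊕ r ≈ p ⊕ (q ⊕ r)
⊕-assoc p q r B =
    upward p (λ {a} → upward q (λ {b} → upward r (λ {c} → subst B (+-assoc a b c))))
  , upward p (λ {a} → upward q (λ {b} → upward r (λ {c} → subst B (sym (+-assoc a b c)))))

mem-U : ∀ u → mem u U
mem-U u = upward u (λ _ → tt) (positive u)

mem-zipWith : ∀ u {A B C : Pred ℕ 0ℓ} → (∀ {x} → A x → B x → C x) →
              mem u A → mem u B → mem u C
mem-zipWith u f A∈u B∈u = upward u (λ (a , b) → f a b) (inter u A∈u B∈u)

mem-zipWith₃ : ∀ u {A B C D : Pred ℕ 0ℓ} → (∀ {x} → A x → B x → C x → D x) →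
               mem u A → mem u B → mem u C → mem u D
mem-zipWith₃ u f A∈u B∈u = mem-zipWith u (λ (a , b) → f a b) (inter u A∈u B∈u)

AlmostConstant : Ultrafilter → (ℕ → ℕ) → Set
AlmostConstant u f = ∃[ j ] mem u (λ x → f x ≡ j)

almostConstant-or-≥ : ∀ u f i → AlmostConstant u f ⊎ mem u (λ x → i ≤ f x)
almostConstant-or-≥ u f zero = inj₂ (upward u (λ _ → z≤n) (mem-U u))
almostConstant-or-≥ u f (suc i) with almostConstant-or-≥ u f i | ultra u (λ x → f x ≡ i)
... | inj₁ constant | _         = inj₁ constant
... | inj₂ _        | inj₁ f≡i  = inj₁ (i , f≡i)
... | inj₂ i≤f      | inj₂ f≢i  =
  inj₂ (mem-zipWith u (λ i≤fx fx≢i → ≤∧≢⇒< i≤fx (λ i≡fx → fx≢i (sym i≡fx))) i≤f f≢i)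

bounded⇒almostConstant : ∀ u f m → (∀ x → f x < m) → AlmostConstant u f
bounded⇒almostConstant u f m f<m with almostConstant-or-≥ u f m
... | inj₁ constant = constant
... | inj₂ m≤f      = ⊥-elim (proper u (upward u (λ {x} → <⇒≱ (f<m x)) m≤f))

¬almostConstant⇒≥ : ∀ {u f} → ¬ AlmostConstant u f → ∀ i → mem u (λ x → i ≤ f x)
¬almostConstant⇒≥ {u} {f} ¬constant i with almostConstant-or-≥ u f i
... | inj₁ constant = ⊥-elim (¬constant constant)
... | inj₂ i≤f      = i≤f

-- _≈_ and _⊕_ unfold into statements about mem, from which Agda cannot infer
-- the ultrafilters involved; hence the implicit arguments given explicitly
-- throughout.  Being a record, NonPrincipal u does determine u.
record NonPrincipal (u : Ultrafilter) : Set where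
  constructor nonPrincipal
  field tails : ∀ j → mem u (j ≤_)

open NonPrincipal public

⊕-nonPrincipalˡ : ∀ {p q} → NonPrincipal p → NonPrincipal (p ⊕ q)
⊕-nonPrincipalˡ {p} {q} p-np = nonPrincipal λ j →
  upward p (λ {a} j≤a → upward q (λ {b} _ → ≤-trans j≤a (m≤m+n a b)) (mem-U q)) (tails p-np j)

⊕-nonPrincipalʳ : ∀ {p q} → NonPrincipal q → NonPrincipal (p ⊕ q)
⊕-nonPrincipalʳ {p} {q} q-np = nonPrincipal λ j →
  upward p (λ {a} _ → upward q (λ {b} j≤b → ≤-trans j≤b (m≤n+m b a)) (tails q-np j)) (mem-U p)

nonPrincipal-cosubsingleton : ∀ {u} {P : Pred ℕ 0ℓ} → NonPrincipal u →
                              (∀ {a b} → ¬ P a → ¬ P b → a ≡ b) → mem u P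
nonPrincipal-cosubsingleton {u} {P} u-np ∁P-subsingleton with ultra u P
... | inj₁ P∈u  = P∈u
... | inj₂ ∁P∈u = ⊥-elim (proper u (upward u (λ {a} ¬Pa → proper u (mem-zipWith u
        (λ ¬Pb a<b → <⇒≢ a<b (∁P-subsingleton ¬Pa ¬Pb)) ∁P∈u (tails u-np (suc a)))) ∁P∈u))

βℕ⊕_⊕βℕ : Ultrafilter → Pred Ultrafilter (lsuc 0ℓ)
(βℕ⊕ q ⊕βℕ) x = Σ Ultrafilter λ s → Σ Ultrafilter λ u → x ≈ s ⊕ q ⊕ u

βℕ⊕-⊕βℕ-isIdeal : ∀ q → IsIdeal (βℕ⊕ q ⊕βℕ)
βℕ⊕-⊕βℕ-isIdeal q = record
  { nonempty = q ⊕ q ⊕ q , q , q , ≈-refl {q ⊕ q ⊕ q}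
  ; respects = λ {x} {y} x≈y (s , u , x≈s⊕q⊕u) → s , u , (begin
      y                    ≈˘⟨ x≈y ⟩
      x                    ≈⟨ x≈s⊕q⊕u ⟩
      s ⊕ q ⊕ u            ∎)
  ; left     = λ v x (s , u , x≈s⊕q⊕u) → v ⊕ s , u , (begin
      v ⊕ x                ≈⟨ ⊕-congʳ v {x} {s ⊕ q ⊕ u} x≈s⊕q⊕u ⟩
      v ⊕ ((s ⊕ q) ⊕ u)    ≈˘⟨ ⊕-assoc v (s ⊕ q) u ⟩
      (v ⊕ (s ⊕ q)) ⊕ u    ≈˘⟨ ⊕-congˡ {v ⊕ s ⊕ q} {v ⊕ (s ⊕ q)} u (⊕-assoc v s q) ⟩
      v ⊕ s ⊕ q ⊕ u        ∎)
  ; right    = λ x v (s , u , x≈s⊕q⊕u) → s , u ⊕ v , (begin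
      x ⊕ v                ≈⟨ ⊕-congˡ {x} {s ⊕ q ⊕ u} v x≈s⊕q⊕u ⟩
      (s ⊕ q ⊕ u) ⊕ v      ≈⟨ ⊕-assoc (s ⊕ q) u v ⟩
      s ⊕ q ⊕ (u ⊕ v)      ∎)
  }
  where open ≈-Reasoning ≈-setoid

⊕-regroup : ∀ s q r u → s ⊕ (q ⊕ r) ⊕ u ≈ (s ⊕ q) ⊕ (r ⊕ u)
⊕-regroup s q r u = begin
  s ⊕ (q ⊕ r) ⊕ u      ≈˘⟨ ⊕-congˡ {s ⊕ q ⊕ r} {s ⊕ (q ⊕ r)} u (⊕-assoc s q r) ⟩
  (s ⊕ q) ⊕ r ⊕ u      ≈⟨ ⊕-assoc (s ⊕ q) r u ⟩
  (s ⊕ q) ⊕ (r ⊕ u)    ∎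
  where open ≈-Reasoning ≈-setoid

Boundary : Pred ℕ 0ℓ → ℕ → Set
Boundary P e = P e × ¬ P (suc e)

boundary-exists : ∀ {P : Pred ℕ 0ℓ} → Decidable P → P 0 → ∀ b → ¬ P b →
                  ∃[ e ] Boundary P e
boundary-exists P? P0 zero    ¬P0   = ⊥-elim (¬P0 P0)
boundary-exists P? P0 (suc b) ¬Pb+1 with P? b
... | yes Pb  = b , Pb , ¬Pb+1
... | no  ¬Pb = boundary-exists P? P0 b ¬Pb

boundary-unique : ∀ {P : Pred ℕ 0ℓ} → (∀ {i j} → i ≤ j → P j → P i) →
                  ∀ {e₁ e₂} → Boundary P e₁ → Boundary P e₂ → e₁ ≡ e₂
boundary-unique P-down {e₁} {e₂} (Pe₁ , ¬Pe₁+1) (Pe₂ , ¬Pe₂+1) with <-cmp e₁ e₂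
... | tri< e₁<e₂ _ _    = ⊥-elim (¬Pe₁+1 (P-down e₁<e₂ Pe₂))
... | tri≈ _ e₁≡e₂ _    = e₁≡e₂
... | tri> _ _ e₂<e₁    = ⊥-elim (¬Pe₂+1 (P-down e₂<e₁ Pe₁))

boundary-shift : ∀ {P Q : Pred ℕ 0ℓ} a →
                 (∀ {e} → P e → Q (a + e)) → (∀ {e} → Q (a + e) → P e) →
                 ∀ {e} → Boundary P e → Boundary Q (a + e)
boundary-shift {Q = Q} a P⇒Q Q⇒P {e} (Pe , ¬Pe+1) =
  P⇒Q Pe , λ Q[a+e+1] → ¬Pe+1 (Q⇒P (subst Q (sym (+-suc a e)) Q[a+e+1]))

∣-+-apart : ∀ {a b d v} → a < b → b < d → d ∣ a + v → ¬ d ∣ b + v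
∣-+-apart {a} {b} {d} {v} a<b b<d d∣a+v d∣b+v =
  <⇒≱ (≤-<-trans (m∸n≤m b a) b<d) (∣⇒≤ {{>-nonZero (m<n⇒0<n∸m a<b)}} d∣b∸a)
  where
  open ≡-Reasoning
  b+v≡a+v+[b∸a] : b + v ≡ a + v + (b ∸ a)
  b+v≡a+v+[b∸a] = begin
    b + v               ≡⟨ cong (_+ v) (sym (m∸n+n≡m (<⇒≤ a<b))) ⟩
    b ∸ a + a + v       ≡⟨ +-assoc (b ∸ a) a v ⟩
    b ∸ a + (a + v)     ≡⟨ +-comm (b ∸ a) (a + v) ⟩
    a + v + (b ∸ a)     ∎
  d∣b∸a : d ∣ b ∸ a
  d∣b∸a = ∣m+n∣m⇒∣n (subst (d ∣_) b+v≡a+v+[b∸a] d∣b+v) d∣a+v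

_≡_[mod_] : ℕ → ℕ → (m : ℕ) → .{{NonZero m}} → Set
x ≡ y [mod m ] = x % m ≡ y % m

infix 4 _≡_[mod_]

+-congˡ-mod : ∀ a {m x y} .{{_ : NonZero m}} → x ≡ y [mod m ] → a + x ≡ a + y [mod m ]
+-congˡ-mod a {m} {x} {y} x≡y = begin
  (a + x) % m             ≡⟨ %-distribˡ-+ a x m ⟩
  (a % m + x % m) % m     ≡⟨ cong (λ r → (a % m + r) % m) x≡y ⟩
  (a % m + y % m) % m     ≡⟨ %-distribˡ-+ a y m ⟨
  (a + y) % m             ∎
  where open ≡-Reasoning

+-shift-≢-mod : ∀ {a m x y} .{{_ : NonZero m}} → 0 < a → a < m →
                x ≡ y [mod m ] → ¬ (a + x ≡ y [mod m ])
+-shift-≢-mod {a} {m} {x} {y} 0<a a<m x≡y a+x≡y = <⇒≱ a<m (∣⇒≤ {{>-nonZero 0<a}} m∣a)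
  where
  open ≡-Reasoning
  c : ℕ
  c = x % m
  [a+c]%m≡c : (a + c) % m ≡ c
  [a+c]%m≡c = begin
    (a + c) % m           ≡⟨ cong (λ a′ → (a′ + c) % m) (m<n⇒m%n≡m a<m) ⟨
    (a % m + x % m) % m   ≡⟨ %-distribˡ-+ a x m ⟨
    (a + x) % m           ≡⟨ trans a+x≡y (sym x≡y) ⟩
    c                     ∎
  m∣a : m ∣ a
  m∣a = divides ((a + c) / m) (+-cancelˡ-≡ c a _ (begin
    c + a                        ≡⟨ +-comm c a ⟩
    a + c                        ≡⟨ m≡m%n+[m/n]*n (a + c) m ⟩
    (a + c) % m + (a + c) / m * m ≡⟨ cong (_+ (a + c) / m * m) [a+c]%m≡c ⟩
    c + (a + c) / m * m          ∎))

residue-almostConstant : ∀ u (f : ℕ → ℕ) m .{{_ : NonZero m}} →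
                         ∃[ r ] mem u (λ x → f x ≡ r [mod m ])
residue-almostConstant u f m
  with bounded⇒almostConstant u (λ x → f x % m) m (λ x → m%n<n (f x) m)
... | r , fx%m≡r =
  r , upward u (λ {x} fx%m≡r → trans (sym (m%n%n≡m%n (f x) m)) (cong (_% m) fx%m≡r)) fx%m≡r

NearResidue : (m : ℕ) .{{_ : NonZero m}} → ℕ → ℕ → Set
NearResidue m r x = x ≡ r [mod m ] ⊎ x ≡ suc r [mod m ]

nearResidue : ∀ {m} r {x y} .{{_ : NonZero m}} → y ≡ r [mod m ] →
              x ≡ y ⊎ x ≡ suc y → NearResidue m r x
nearResidue _ y≡r (inj₁ refl) = inj₁ y≡r
nearResidue _ y≡r (inj₂ refl) = inj₂ (+-congˡ-mod 1 y≡r)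

-- Modulo m, x - r is d - 1, d or d + 1, all strictly between 0 and m.
¬nearResidue : ∀ {m} r {x y d} .{{_ : NonZero m}} → y ≡ r [mod m ] → 2 ≤ d → suc d < m →
               x ≡ d + y ⊎ x ≡ d + suc y → ¬ NearResidue m r x
¬nearResidue _ {d = d} y≡r 2≤d d+1<m (inj₁ refl) (inj₁ x≡r) =
  +-shift-≢-mod (<⇒≤ 2≤d) (<⇒≤ d+1<m) y≡r x≡r
¬nearResidue {m} _ {y = y} {suc d} y≡r (s≤s 1≤d) d+2<m (inj₁ refl) (inj₂ x≡r+1) =
  +-shift-≢-mod 1≤d (<-trans (n<1+n d) (<⇒≤ d+2<m)) (+-congˡ-mod 1 y≡r)
    (trans (cong (_% m) (+-suc d y)) x≡r+1)
¬nearResidue {m} _ {y = y} {d} y≡r _ d+1<m (inj₂ refl) (inj₁ x≡r) =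
  +-shift-≢-mod (s≤s z≤n) d+1<m y≡r (trans (cong (_% m) (sym (+-suc d y))) x≡r)
¬nearResidue _ {d = d} y≡r 2≤d d+1<m (inj₂ refl) (inj₂ x≡r+1) =
  +-shift-≢-mod (<⇒≤ 2≤d) (<⇒≤ d+1<m) (+-congˡ-mod 1 y≡r) x≡r+1

module Base (n : ℕ) (1<n : 1 < n) where

  instance
    n≢0 : NonZero n
    n≢0 = >-nonZero (<⇒≤ 1<n)

  m+m≤n*m : ∀ m → m + m ≤ n * m
  m+m≤n*m m = ≤-trans (≤-reflexive (cong (m +_) (sym (+-identityʳ m)))) (*-monoˡ-≤ m 1<n)

  m<n^m : ∀ m → m < n ^ m
  m<n^m zero    = s≤s z≤n
  m<n^m (suc m) = begin
    2 + m          ≡⟨ +-comm 1 (suc m) ⟩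
    suc m + 1      ≤⟨ +-mono-≤ (m<n^m m) (m^n>0 n m) ⟩
    n ^ m + n ^ m  ≤⟨ m+m≤n*m (n ^ m) ⟩
    n ^ suc m      ∎
    where open ≤-Reasoning

  m<n^k*m : ∀ {k m} → 0 < k → 0 < m → m < n ^ k * m
  m<n^k*m {k} {m} 0<k 0<m = begin-strict
    m          ≡⟨ *-identityˡ m ⟨
    1 * m      <⟨ *-monoˡ-< m {{>-nonZero 0<m}} (^-monoʳ-< n 1<n 0<k) ⟩
    n ^ k * m  ∎
    where open ≤-Reasoning

  n^a*m>0 : ∀ a {m} → 0 < m → 0 < n ^ a * m
  n^a*m>0 a 0<m = *-mono-≤ (m^n>0 n a) 0<m

  n^i∣n^j : ∀ {i j} → i ≤ j → n ^ i ∣ n ^ j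
  n^i∣n^j {i} {j} i≤j = divides (n ^ (j ∸ i)) (begin
    n ^ j                ≡⟨ cong (n ^_) (m∸n+n≡m i≤j) ⟨
    n ^ (j ∸ i + i)      ≡⟨ ^-distribˡ-+-* n (j ∸ i) i ⟩
    n ^ (j ∸ i) * n ^ i  ∎)
    where open ≡-Reasoning

  ⌊log⌋-exists : ∀ x → ∃[ e ] Boundary (λ e → n ^ e ≤ suc x) e
  ⌊log⌋-exists x =
    boundary-exists (λ e → n ^ e ≤? suc x) (s≤s z≤n) (suc x) (<⇒≱ (m<n^m (suc x)))

  ⌊log⌋ : ℕ → ℕ
  ⌊log⌋ zero    = 0
  ⌊log⌋ (suc x) = proj₁ (⌊log⌋-exists x)

  ⌊log⌋-boundary : ∀ {x} → 0 < x → Boundary (λ e → n ^ e ≤ x) (⌊log⌋ x)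
  ⌊log⌋-boundary {suc x} _ = proj₂ (⌊log⌋-exists x)

  ⌊log⌋-unique : ∀ {x e} → 0 < x → Boundary (λ e → n ^ e ≤ x) e → ⌊log⌋ x ≡ e
  ⌊log⌋-unique 0<x = boundary-unique (λ i≤j → ≤-trans (^-monoʳ-≤ n i≤j)) (⌊log⌋-boundary 0<x)

  ⌊log⌋-n^a* : ∀ a {x} → 0 < x → ⌊log⌋ (n ^ a * x) ≡ a + ⌊log⌋ x
  ⌊log⌋-n^a* a {x} 0<x =
    ⌊log⌋-unique (n^a*m>0 a 0<x)
      (boundary-shift {Q = λ e → n ^ e ≤ n ^ a * x} a scale unscale (⌊log⌋-boundary 0<x))
    where
    scale : ∀ {e} → n ^ e ≤ x → n ^ (a + e) ≤ n ^ a * x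
    scale {e} n^e≤x = subst (_≤ n ^ a * x) (sym (^-distribˡ-+-* n a e)) (*-monoʳ-≤ (n ^ a) n^e≤x)
    unscale : ∀ {e} → n ^ (a + e) ≤ n ^ a * x → n ^ e ≤ x
    unscale {e} n^[a+e]≤n^a*x =
      *-cancelˡ-≤ (n ^ a) {{m^n≢0 n a}} (subst (_≤ n ^ a * x) (^-distribˡ-+-* n a e) n^[a+e]≤n^a*x)

  ⌊log⌋-+ : ∀ {y v} → y ≤ v → 0 < v →
            ⌊log⌋ (y + v) ≡ ⌊log⌋ v ⊎ ⌊log⌋ (y + v) ≡ suc (⌊log⌋ v)
  ⌊log⌋-+ {y} {v} y≤v 0<v = by-cases (n ^ suc e ≤? y + v)
    where
    e = ⌊log⌋ v
    n^e≤v : n ^ e ≤ v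
    n^e≤v = proj₁ (⌊log⌋-boundary 0<v)
    0<y+v : 0 < y + v
    0<y+v = m≤n⇒m≤o+n y 0<v
    v<n^[e+1] : v < n ^ suc e
    v<n^[e+1] = ≰⇒> (proj₂ (⌊log⌋-boundary 0<v))
    y+v<n^[e+2] : y + v < n ^ suc (suc e)
    y+v<n^[e+2] = begin-strict
      y + v                  ≤⟨ +-monoˡ-≤ v y≤v ⟩
      v + v                  <⟨ +-mono-< v<n^[e+1] v<n^[e+1] ⟩
      n ^ suc e + n ^ suc e  ≤⟨ m+m≤n*m (n ^ suc e) ⟩
      n ^ suc (suc e)        ∎
      where open ≤-Reasoning
    by-cases : Dec (n ^ suc e ≤ y + v) → ⌊log⌋ (y + v) ≡ e ⊎ ⌊log⌋ (y + v) ≡ suc e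
    by-cases (no  n^[e+1]≰y+v) =
      inj₁ (⌊log⌋-unique 0<y+v (≤-trans n^e≤v (m≤n+m v y) , n^[e+1]≰y+v))
    by-cases (yes n^[e+1]≤y+v) =
      inj₂ (⌊log⌋-unique 0<y+v (n^[e+1]≤y+v , <⇒≱ y+v<n^[e+2]))

  ν-exists : ∀ x → ∃[ e ] Boundary (λ e → n ^ e ∣ suc x) e
  ν-exists x =
    boundary-exists (λ e → n ^ e ∣? suc x) (1∣ suc x) (suc x) (>⇒∤ (m<n^m (suc x)))

  ν : ℕ → ℕ
  ν zero    = 0
  ν (suc x) = proj₁ (ν-exists x)

  ν-boundary : ∀ {x} → 0 < x → Boundary (λ e → n ^ e ∣ x) (ν x)
  ν-boundary {suc x} _ = proj₂ (ν-exists x)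

  ν-unique : ∀ {x e} → 0 < x → Boundary (λ e → n ^ e ∣ x) e → ν x ≡ e
  ν-unique 0<x = boundary-unique (λ i≤j → ∣-trans (n^i∣n^j i≤j)) (ν-boundary 0<x)

  ν-divides : ∀ {k} x → k ≤ ν x → n ^ k ∣ x
  ν-divides {k} zero    _      = (n ^ k) ∣0
  ν-divides     (suc x) k≤νx = ∣-trans (n^i∣n^j k≤νx) (proj₁ (ν-boundary {suc x} (s≤s z≤n)))

  ν-n^a* : ∀ a {x} → 0 < x → ν (n ^ a * x) ≡ a + ν x
  ν-n^a* a {x} 0<x =
    ν-unique (n^a*m>0 a 0<x)
      (boundary-shift {Q = λ e → n ^ e ∣ n ^ a * x} a scale unscale (ν-boundary 0<x))
    where
    scale : ∀ {e} → n ^ e ∣ x → n ^ (a + e) ∣ n ^ a * x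
    scale {e} n^e∣x = subst (_∣ n ^ a * x) (sym (^-distribˡ-+-* n a e)) (*-monoʳ-∣ (n ^ a) n^e∣x)
    unscale : ∀ {e} → n ^ (a + e) ∣ n ^ a * x → n ^ e ∣ x
    unscale {e} n^[a+e]∣n^a*x =
      *-cancelˡ-∣ (n ^ a) {{m^n≢0 n a}} (subst (_∣ n ^ a * x) (^-distribˡ-+-* n a e) n^[a+e]∣n^a*x)

  ν-+-¬almostConstant-apart : ∀ u {a b} → a < b → ¬ AlmostConstant u (λ v → ν (a + v)) →
                              ¬ ¬ AlmostConstant u (λ v → ν (b + v))
  ν-+-¬almostConstant-apart u {a} {b} a<b ¬const-a ¬const-b = proper u (mem-zipWith u
    (λ {v} b≤ν[a+v] b≤ν[b+v] →
      ∣-+-apart a<b (m<n^m b) (ν-divides (a + v) b≤ν[a+v]) (ν-divides (b + v) b≤ν[b+v]))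
    (¬almostConstant⇒≥ {u} ¬const-a b) (¬almostConstant⇒≥ {u} ¬const-b b))

  ν-+-¬almostConstant-unique : ∀ u {a b} → ¬ AlmostConstant u (λ v → ν (a + v)) →
                               ¬ AlmostConstant u (λ v → ν (b + v)) → a ≡ b
  ν-+-¬almostConstant-unique u {a} {b} ¬const-a ¬const-b with <-cmp a b
  ... | tri< a<b _ _ = ⊥-elim (ν-+-¬almostConstant-apart u a<b ¬const-a ¬const-b)
  ... | tri≈ _ a≡b _ = a≡b
  ... | tri> _ _ b<a = ⊥-elim (ν-+-¬almostConstant-apart u b<a ¬const-b ¬const-a)

  _⋆_ : Ultrafilter → Ultrafilter → Ultrafilter
  _⋆_ = star n 1<n

  ⋆-congʳ : ∀ p {q₁ q₂} → q₁ ≈ q₂ → p ⋆ q₁ ≈ p ⋆ q₂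
  ⋆-congʳ p q₁≈q₂ A = upward p (proj₁ (q₁≈q₂ _)) , upward p (proj₂ (q₁≈q₂ _))

  ⋆-idempotent⇒nonPrincipal : ∀ {p} → p ⋆ p ≈ p → NonPrincipal p
  ⋆-idempotent⇒nonPrincipal {p} p⋆p≈p = nonPrincipal tails-p
    where
    tails-p : ∀ j → mem p (j ≤_)
    tails-p zero    = upward p (λ _ → z≤n) (mem-U p)
    tails-p (suc j) = proj₁ (p⋆p≈p (suc j ≤_))
      (upward p (λ {a} 0<a → mem-zipWith p (λ {b} j≤b 0<b → ≤-<-trans j≤b (m<n^k*m 0<a 0<b))
                               (tails-p j) (positive p))
                (positive p))

  module _ (u : Ultrafilter) where

    typicalResidue : ℕ → ℕ
    typicalResidue j = proj₁ (residue-almostConstant u ⌊log⌋ (2 + j))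

    typicalResidue-mem : ∀ j → mem u (λ v → ⌊log⌋ v ≡ typicalResidue j [mod 2 + j ])
    typicalResidue-mem j = proj₂ (residue-almostConstant u ⌊log⌋ (2 + j))

    Typical : Pred ℕ 0ℓ
    Typical x = NearResidue (2 + ν x) (typicalResidue (ν x)) (⌊log⌋ x)

    typical-+ : ∀ {y j v} → ν (y + v) ≡ j → ⌊log⌋ v ≡ typicalResidue j [mod 2 + j ] → y < v →
                Typical (y + v)
    typical-+ {y} {v = v} refl log-v≡r y<v =
      nearResidue (typicalResidue (ν (y + v))) log-v≡r (⌊log⌋-+ (<⇒≤ y<v) (m<n⇒0<n y<v))

    ¬typical-n^α* : ∀ {α y j v} → 2 ≤ α → ν (y + v) ≡ j →
                    ⌊log⌋ v ≡ typicalResidue (α + j) [mod 2 + (α + j) ] → y < v →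
                    ¬ Typical (n ^ α * (y + v))
    ¬typical-n^α* {α} {y} {v = v} 2≤α refl log-v≡r y<v
      rewrite ν-n^a* α (m≤n⇒m≤o+n y (m<n⇒0<n y<v))
            | ⌊log⌋-n^a* α (m≤n⇒m≤o+n y (m<n⇒0<n y<v)) =
      ¬nearResidue (typicalResidue (α + ν (y + v))) log-v≡r
        2≤α (s≤s (s≤s (m≤m+n α (ν (y + v)))))
        (map (cong (α +_)) (cong (α +_)) (⌊log⌋-+ (<⇒≤ y<v) (m<n⇒0<n y<v)))

    almostConstant-ν-+ : ∀ {s} → NonPrincipal s →
                         mem s (λ y → AlmostConstant u (λ v → ν (y + v)))
    almostConstant-ν-+ s-np = nonPrincipal-cosubsingleton s-np (ν-+-¬almostConstant-unique u)

    typical∈⊕ : ∀ {s} → NonPrincipal s → NonPrincipal u → mem (s ⊕ u) Typical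
    typical∈⊕ {s} s-np u-np = upward s
      (λ {y} (j , ν≡j) → mem-zipWith₃ u typical-+ ν≡j (typicalResidue-mem j) (tails u-np (suc y)))
      (almostConstant-ν-+ s-np)

    n^α*-atypical∈⊕ : ∀ {s α} → NonPrincipal s → NonPrincipal u → 2 ≤ α →
                      mem (s ⊕ u) (λ x → ¬ Typical (n ^ α * x))
    n^α*-atypical∈⊕ {s} {α} s-np u-np 2≤α = upward s
      (λ {y} (j , ν≡j) →
        mem-zipWith₃ u (¬typical-n^α* 2≤α) ν≡j (typicalResidue-mem (α + j)) (tails u-np (suc y)))
      (almostConstant-ν-+ s-np)

  ⋆-idempotent-≉-⊕ : ∀ {p s u} → p ⋆ p ≈ p → NonPrincipal s → NonPrincipal u →
                     ¬ (s ⊕ u ≈ p)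
  ⋆-idempotent-≉-⊕ {p} {s} {u} p⋆p≈p s-np u-np s⊕u≈p =
    proper p (mem-zipWith p (λ typical atypical → atypical typical) typical∈p atypical∈p)
    where
    typical∈p : mem p (Typical u)
    typical∈p = proj₁ (s⊕u≈p _) (typical∈⊕ u s-np u-np)
    atypical∈p : mem p (∁ (Typical u))
    atypical∈p = proj₁ (p⋆p≈p _) (proj₁ (⋆-congʳ p {s ⊕ u} {p} s⊕u≈p (∁ (Typical u)))
      (upward p (n^α*-atypical∈⊕ u s-np u-np) (tails (⋆-idempotent⇒nonPrincipal {p} p⋆p≈p) 2)))

K-factorisation : ∀ {p} → InK p →
                  Σ Ultrafilter λ s → Σ Ultrafilter λ u → (s ⊕ p) ⊕ (p ⊕ u) ≈ p
K-factorisation {p} p∈K with p∈K (βℕ⊕ (p ⊕ p) ⊕βℕ) (βℕ⊕-⊕βℕ-isIdeal (p ⊕ p))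
... | s , u , p≈s⊕[p⊕p]⊕u = s , u , (begin
  (s ⊕ p) ⊕ (p ⊕ u)  ≈˘⟨ ⊕-regroup s p p u ⟩
  s ⊕ (p ⊕ p) ⊕ u    ≈˘⟨ p≈s⊕[p⊕p]⊕u ⟩
  p                  ∎)
  where open ≈-Reasoning ≈-setoid

theorem1p11 : ∀ (n : ℕ) (1<n : 1 < n) (p : Ultrafilter) →
    star n 1<n p p ≈ p → ¬ (InK p ⊎ InE p)
theorem1p11 n 1<n p p⋆p≈p = [ p∉K , p∉E ]
  where
  open Base n 1<n
  p-np : NonPrincipal p
  p-np = ⋆-idempotent⇒nonPrincipal {p} p⋆p≈p
  p∉K : ¬ InK p
  p∉K p∈K with K-factorisation p∈K
  ... | s , u , s⊕p⊕p⊕u≈p =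
    ⋆-idempotent-≉-⊕ {p} p⋆p≈p (⊕-nonPrincipalʳ {s} p-np) (⊕-nonPrincipalˡ {q = u} p-np) s⊕p⊕p⊕u≈p
  p∉E : ¬ InE p
  p∉E = ⋆-idempotent-≉-⊕ {p} p⋆p≈p p-np p-np
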